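{- Let $d_1,d_2,d_3,d_4$ be pairwise distinct elements of $\{1,\dots,\lfloor u/2\rfloor\}\setminus\{\frac u2\}$ such that $d_3=d_2-d_1$ or $d_1+d_2+d_3=u$. Then the graph $\langle \mathbb Z_u\cup\{\infty_1,\infty_2\},\{d_1,d_2,d_3,d_4\}\rangle$ can be decomposed into $3$-suns.
   Context: A $3$-sun is the graph on six vertices $a,b,c,d,e,f$ with edges $\{a,b\},\{b,c\},\{c,a\},\{a,d\},\{b,e\},\{c,f\}$; a decomposition of a graph into $3$-suns is a partition of its edge set into subgraphs isomorphic to a $3$-sun. For a positive integer $u$, $\mathbb Z_u=\{0,1,\dots,u-1\}$ (integers mod $u$), and for distinct $i,j\in\mathbb Z_u$, $|i-j|_u=\min\{|i-j|,u-|i-j|\}$. For a set $H$ disjoint from $\mathbb Z_u$ and a nonempty set $D\subseteq\{1,\dots,\lfloor u/2\rfloor\}$, $\langle \mathbb Z_u\cup H,D\rangle$ is the graph with vertex set $\mathbb Z_u\cup H$ and edge set $\{\{i,j\}: i,j\in\mathbb Z_u,\ |i-j|_u\in D\}\cup\{\{\infty,i\}:\infty\in H,\ i\in\mathbb Z_u\}$. -}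

module Defs where

open import Data.Nat using (ℕ; _∸_; ∣_-_∣; _⊓_)
open import Data.Fin using (Fin; toℕ)
import Data.Fin.Properties as FinP
open import Data.Sum using (_⊎_; inj₁; inj₂)
open import Data.Sum.Properties using (≡-dec)
open import Data.Product using (_×_; _,_; Σ-syntax)
open import Data.List using (List; []; _∷_; concatMap; filter; length)
open import Data.List.Relation.Unary.All using (All)
open import Data.List.Relation.Unary.Unique.Propositional using (Unique)
open import Data.List.Membership.Propositional using (_∈_)
open import Data.Empty using (⊥)
open import Data.Unit using (⊤)
open import Relation.Nullary using (¬_; Dec)
open import Relation.Nullary.Decidable using (_×-dec_; _⊎-dec_)
open import Relation.Binary.PropositionalEquality using (_≡_)

-- Vertex set  Z_u ∪ {∞₁, ∞₂}:  inj₁ i  is i ∈ Z_u,  inj₂ h  is ∞_{h+1}.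
Vtx : ℕ → Set
Vtx u = Fin u ⊎ Fin 2

_≟V_ : ∀ {u} (x y : Vtx u) → Dec (x ≡ y)
_≟V_ = ≡-dec FinP._≟_ FinP._≟_

distU : ∀ {u} → Fin u → Fin u → ℕ
distU {u} i j = ∣ toℕ i - toℕ j ∣ ⊓ (u ∸ ∣ toℕ i - toℕ j ∣)

Adj : ∀ {u} → List ℕ → Vtx u → Vtx u → Set
Adj D (inj₁ i) (inj₁ j) = ¬ (i ≡ j) × (distU i j ∈ D)
Adj D (inj₁ i) (inj₂ h) = ⊤
Adj D (inj₂ h) (inj₁ j) = ⊤
Adj D (inj₂ h) (inj₂ k) = ⊥

record Sun (V : Set) : Set where
  field
    a b c d e f : V
    distinct : Unique (a ∷ b ∷ c ∷ d ∷ e ∷ f ∷ [])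

Edge : Set → Set
Edge V = V × V

sunEdges : ∀ {V} → Sun V → List (Edge V)
sunEdges s = (a , b) ∷ (b , c) ∷ (c , a) ∷ (a , d) ∷ (b , e) ∷ (c , f) ∷ []
  where open Sun s

SameEdge : ∀ {V : Set} → Edge V → Edge V → Set
SameEdge (x , y) (p , q) = (x ≡ p × y ≡ q) ⊎ (x ≡ q × y ≡ p)

sameEdge? : ∀ {u} (e e' : Edge (Vtx u)) → Dec (SameEdge e e')
sameEdge? (x , y) (p , q) = ((x ≟V p) ×-dec (y ≟V q)) ⊎-dec ((x ≟V q) ×-dec (y ≟V p))

edgeCount : ∀ {u} → List (Sun (Vtx u)) → Vtx u → Vtx u → ℕ
edgeCount S x y = length (filter (λ e → sameEdge? e (x , y)) (concatMap sunEdges S))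

SunDecomposition : ℕ → List ℕ → Set
SunDecomposition u D =
  Σ[ S ∈ List (Sun (Vtx u)) ]
    ( All (λ s → All (λ { (x , y) → Adj D x y }) (sunEdges s)) S
    × (∀ (x y : Vtx u) → Adj D x y → edgeCount S x y ≡ 1))

module Submission where

-- The decomposition is the development over ℤ_u of one base sun: the triangle 0, p, q with
-- pendant edges {0, r}, {p, ∞₁}, {q, ∞₂}, translated by every z ∈ ℤ_u. With p = d₁, r = d₄ and
-- q = d₂ (if d₃ = d₂ − d₁) or q = d₁ + d₂ (if d₁ + d₂ + d₃ = u), the four finite edges of the
-- base sun have the distinct cyclic lengths d₁, …, d₄. An edge {x, y} has length d iff
-- y ≡ x + d or x ≡ y + d, and since 0 < 2d < u at most one of these holds; hence the u
-- translates of a finite edge of length d cover each edge of length d exactly once, while the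
-- translates of {p, ∞₁} and {q, ∞₂} cover each edge at ∞₁ and ∞₂ exactly once.

open import Defs
open import Data.Empty using (⊥-elim)
open import Data.Fin using (Fin; zero; suc; toℕ)
open import Data.Fin.Patterns using (0F; 1F)
open import Data.Fin.Properties using (toℕ-injective; toℕ<n; toℕ-fromℕ<)
import Data.Fin.Properties as Finₚ
open import Data.List using (List; []; _∷_; _++_; map; filter; length; concatMap; tabulate)
open import Data.List.Membership.Propositional using (_∈_)
open import Data.List.Properties using (map-++; map-cong)
open import Data.List.Relation.Binary.Permutation.Propositional using (_↭_; refl; prep; swap; ↭-sym)
open import Data.List.Relation.Binary.Permutation.Propositional.Properties using (∈-resp-↭)
open import Data.List.Relation.Unary.All as All using (All; []; _∷_)
open import Data.List.Relation.Unary.All.Properties using (tabulate⁺)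
open import Data.List.Relation.Unary.AllPairs using ([]; _∷_)
open import Data.List.Relation.Unary.Any using (here; there)
open import Data.List.Relation.Unary.Unique.Propositional using (Unique)
open import Data.Nat using (ℕ; zero; suc; _+_; _*_; _∸_; _⊓_; _≤_; _<_; ∣_-_∣; NonZero; >-nonZero⁻¹; z<s)
import Data.Nat as ℕ
open import Data.Nat.DivMod
  using (_/_; m/n*n≤m; _%_; _mod_; %-distribˡ-+; m%n%n≡m%n; [m+n]%n≡m%n; m%n≤n; m%n<n; m<n⇒m%n≡m)
open import Data.Nat.ListAction using (sum)
open import Data.Nat.ListAction.Properties using (sum-++)
open import Data.Nat.Properties
open import Algebra.Properties.CommutativeSemigroup +-commutativeSemigroup using (xy∙z≈xz∙y; x∙yz≈xz∙y)
open import Algebra.Properties.CommutativeMonoid.Sum +-0-commutativeMonoid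
  using (sum-syntax; ∑-distrib-+; sum-cong-≗; sum-replicate-zero)
open import Data.Product using (_×_; _,_; proj₁; proj₂)
open import Data.Product.Function.NonDependent.Propositional using (_×-⇔_)
open import Data.Sum using (_⊎_; inj₁; inj₂; [_,_])
import Data.Sum as Sum
open import Data.Sum.Function.Propositional using (_⊎-⇔_)
open import Data.Sum.Properties using (inj₁-injective; inj₂-injective)
open import Data.Unit using (tt)
open import Function using (_∘_; _⇔_; mk⇔; Equivalence)
import Function.Properties.Equivalence as ⇔
open import Relation.Binary.Definitions using (DecidableEquality)
open import Relation.Binary.PropositionalEquality
  using (_≡_; _≢_; refl; sym; trans; cong; cong₂; subst; subst₂; module ≡-Reasoning)
open import Relation.Nullary using (¬_; Dec; yes; no)
open import Relation.Nullary.Decidable using (_×-dec_; _⊎-dec_)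
open import Relation.Unary using (Decidable)

open Equivalence using (to; from)

-- Counting with indicators

𝟙 : ∀ {a} {A : Set a} → Dec A → ℕ
𝟙 (yes _) = 1
𝟙 (no _)  = 0

private
  variable
    A B : Set

𝟙-yes : (a? : Dec A) → A → 𝟙 a? ≡ 1
𝟙-yes (yes _) _ = refl
𝟙-yes (no ¬a) a = ⊥-elim (¬a a)

𝟙-no : (a? : Dec A) → ¬ A → 𝟙 a? ≡ 0
𝟙-no (yes a) ¬a = ⊥-elim (¬a a)
𝟙-no (no _)  _  = refl

𝟙-⇔ : A ⇔ B → (a? : Dec A) (b? : Dec B) → 𝟙 a? ≡ 𝟙 b?
𝟙-⇔ A⇔B (yes a) b? = sym (𝟙-yes b? (to A⇔B a))
𝟙-⇔ A⇔B (no ¬a) b? = sym (𝟙-no b? (¬a ∘ from A⇔B))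

𝟙-⊎ : ¬ (A × B) → (a? : Dec A) (b? : Dec B) → 𝟙 (a? ⊎-dec b?) ≡ 𝟙 a? + 𝟙 b?
𝟙-⊎ ¬a×b (yes a) (yes b) = ⊥-elim (¬a×b (a , b))
𝟙-⊎ ¬a×b (yes a) (no _)  = refl
𝟙-⊎ ¬a×b (no _)  (yes b) = refl
𝟙-⊎ ¬a×b (no _)  (no _)  = refl

module _ {n : ℕ} where

  ∑-𝟙-∅ : {Q : Fin n → Set} (Q? : Decidable Q) → (∀ z → ¬ Q z) → ∑[ z < n ] 𝟙 (Q? z) ≡ 0
  ∑-𝟙-∅ Q? ¬Q = trans (sum-cong-≗ (λ z → 𝟙-no (Q? z) (¬Q z))) (sum-replicate-zero n)

∑-𝟙-≟ : ∀ {n} (w : Fin n) → ∑[ z < n ] 𝟙 (z Finₚ.≟ w) ≡ 1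
∑-𝟙-≟ {suc n} zero = cong suc (∑-𝟙-∅ {n} (λ z → suc z Finₚ.≟ zero) (λ _ ()))
∑-𝟙-≟ (suc w) = trans (sum-cong-≗ shifted) (∑-𝟙-≟ w)
  where
  shifted : ∀ z → 𝟙 (suc z Finₚ.≟ suc w) ≡ 𝟙 (z Finₚ.≟ w)
  shifted z = 𝟙-⇔ (mk⇔ Finₚ.suc-injective (cong suc)) (suc z Finₚ.≟ suc w) (z Finₚ.≟ w)

module _ {n : ℕ} where

  ∑-𝟙-single : {Q : Fin n → Set} (Q? : Decidable Q) (w : Fin n) (A? : Dec A) →
               (∀ z → Q z ⇔ (z ≡ w × A)) → ∑[ z < n ] 𝟙 (Q? z) ≡ 𝟙 A?
  ∑-𝟙-single {Q = Q} Q? w (yes a) Q⇔ =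
    trans (sum-cong-≗ (λ z → 𝟙-⇔ (Q⇔≡w z) (Q? z) (z Finₚ.≟ w))) (∑-𝟙-≟ w)
    where
    Q⇔≡w : ∀ z → Q z ⇔ z ≡ w
    Q⇔≡w z = mk⇔ (proj₁ ∘ to (Q⇔ z)) (λ z≡w → from (Q⇔ z) (z≡w , a))
  ∑-𝟙-single Q? w (no ¬a) Q⇔ = ∑-𝟙-∅ Q? (λ z → ¬a ∘ proj₂ ∘ to (Q⇔ z))

  ∑-𝟙-pair : {Q : Fin n → Set} (Q? : Decidable Q) (w₁ w₂ : Fin n) (A? : Dec A) (B? : Dec B) →
             w₁ ≢ w₂ →
             (∀ z → Q z ⇔ ((z ≡ w₁ × A) ⊎ (z ≡ w₂ × B))) →
             ∑[ z < n ] 𝟙 (Q? z) ≡ 𝟙 A? + 𝟙 B?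
  ∑-𝟙-pair {A = A} {B = B} Q? w₁ w₂ A? B? w₁≢w₂ Q⇔ = begin
    ∑[ z < n ] 𝟙 (Q? z)                               ≡⟨ sum-cong-≗ split ⟩
    ∑[ z < n ] (𝟙 (first z) + 𝟙 (second z))           ≡⟨ ∑-distrib-+ (𝟙 ∘ first) (𝟙 ∘ second) ⟩
    ∑[ z < n ] 𝟙 (first z) + ∑[ z < n ] 𝟙 (second z) ≡⟨ cong₂ _+_ (∑-𝟙-single first w₁ A? (λ _ → ⇔.refl))
                                                                  (∑-𝟙-single second w₂ B? (λ _ → ⇔.refl)) ⟩
    𝟙 A? + 𝟙 B?                                       ∎
    where
    open ≡-Reasoning
    first : ∀ z → Dec (z ≡ w₁ × A)
    first z = (z Finₚ.≟ w₁) ×-dec A?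
    second : ∀ z → Dec (z ≡ w₂ × B)
    second z = (z Finₚ.≟ w₂) ×-dec B?
    split : ∀ z → 𝟙 (Q? z) ≡ 𝟙 (first z) + 𝟙 (second z)
    split z = trans (𝟙-⇔ (Q⇔ z) (Q? z) (first z ⊎-dec second z))
                    (𝟙-⊎ (λ ((z≡w₁ , _) , (z≡w₂ , _)) → w₁≢w₂ (trans (sym z≡w₁) z≡w₂))
                         (first z) (second z))

length-filter≡sum-𝟙 : {P : A → Set} (P? : Decidable P) (xs : List A) →
                      length (filter P? xs) ≡ sum (map (𝟙 ∘ P?) xs)
length-filter≡sum-𝟙 P? []       = refl
length-filter≡sum-𝟙 P? (x ∷ xs) with P? x
... | yes _ = cong suc (length-filter≡sum-𝟙 P? xs)
... | no  _ = length-filter≡sum-𝟙 P? xs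

sum-map-concatMap-tabulate : ∀ {n} (f : B → ℕ) (g : A → List B) (s : Fin n → A) →
  sum (map f (concatMap g (tabulate s))) ≡ ∑[ z < n ] sum (map f (g (s z)))
sum-map-concatMap-tabulate {n = zero}  f g s = refl
sum-map-concatMap-tabulate {B = B} {n = suc n} f g s = begin
  sum (map f (g (s zero) ++ rest))            ≡⟨ cong sum (map-++ f (g (s zero)) rest) ⟩
  sum (map f (g (s zero)) ++ map f rest)      ≡⟨ sum-++ (map f (g (s zero))) (map f rest) ⟩
  sum (map f (g (s zero))) + sum (map f rest) ≡⟨ cong (sum (map f (g (s zero))) +_)
                                                      (sum-map-concatMap-tabulate f g (s ∘ suc)) ⟩
  ∑[ z < suc n ] sum (map f (g (s z)))        ∎
  where
  open ≡-Reasoning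
  rest : List B
  rest = concatMap g (tabulate (s ∘ suc))

∑-sum-map : ∀ {n} (fs : List (Fin n → ℕ)) →
            ∑[ z < n ] sum (map (λ f → f z) fs) ≡ sum (map (λ f → ∑[ z < n ] f z) fs)
∑-sum-map {n} []       = sum-replicate-zero n
∑-sum-map {n} (f ∷ fs) = trans (∑-distrib-+ f (λ z → sum (map (λ g → g z) fs)))
                               (cong (∑[ z < n ] f z +_) (∑-sum-map fs))

module _ (_≟_ : DecidableEquality A) where

  sum-𝟙-∉ : ∀ {m} {es : List A} → All (m ≢_) es → sum (map (λ e → 𝟙 (m ≟ e)) es) ≡ 0
  sum-𝟙-∉ []           = refl
  sum-𝟙-∉ (m≢e ∷ m∉es) = cong₂ _+_ (𝟙-no _ m≢e) (sum-𝟙-∉ m∉es)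

  sum-𝟙-unique : ∀ {m} {es : List A} → Unique es → m ∈ es → sum (map (λ e → 𝟙 (m ≟ e)) es) ≡ 1
  sum-𝟙-unique (e∉es ∷ _)      (here refl) = cong₂ _+_ (𝟙-yes _ refl) (sum-𝟙-∉ e∉es)
  sum-𝟙-unique (e∉es ∷ unique) (there m∈es) =
    cong₂ _+_ (𝟙-no _ (λ m≡e → All.lookup e∉es m∈es (sym m≡e))) (sum-𝟙-unique unique m∈es)

m+m<o⇒n+n<o⇒m+n<o : ∀ {m n o} → m + m < o → n + n < o → m + n < o
m+m<o⇒n+n<o⇒m+n<o {m} {n} m+m<o n+n<o with ≤-total m n
... | inj₁ m≤n = ≤-<-trans (+-monoˡ-≤ n m≤n) n+n<o
... | inj₂ n≤m = ≤-<-trans (+-monoʳ-≤ m n≤m) m+m<o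


edgeCount-tabulate : ∀ {u n} (s : Fin n → Sun (Vtx u)) (x y : Vtx u) →
  edgeCount (tabulate s) x y ≡ ∑[ z < n ] sum (map (λ e → 𝟙 (sameEdge? e (x , y))) (sunEdges (s z)))
edgeCount-tabulate s x y =
  trans (length-filter≡sum-𝟙 (λ e → sameEdge? e (x , y)) (concatMap sunEdges (tabulate s)))
        (sum-map-concatMap-tabulate (λ e → 𝟙 (sameEdge? e (x , y))) sunEdges s)

edgeCount-comm : ∀ {u} (S : List (Sun (Vtx u))) (x y : Vtx u) →
                 edgeCount S x y ≡ edgeCount S y x
edgeCount-comm {u} S x y = begin
  edgeCount S x y                                 ≡⟨ length-filter≡sum-𝟙 _ edges ⟩
  sum (map (λ e → 𝟙 (sameEdge? e (x , y))) edges) ≡⟨ cong sum (map-cong (λ e → 𝟙-⇔ swapped _ _) edges) ⟩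
  sum (map (λ e → 𝟙 (sameEdge? e (y , x))) edges) ≡⟨ length-filter≡sum-𝟙 _ edges ⟨
  edgeCount S y x                                 ∎
  where
  open ≡-Reasoning
  edges : List (Edge (Vtx u))
  edges = concatMap sunEdges S
  swapped : ∀ {e} → SameEdge e (x , y) ⇔ SameEdge e (y , x)
  swapped = mk⇔ Sum.swap Sum.swap

-- Arithmetic modulo u

module CyclicArithmetic (u : ℕ) .{{_ : NonZero u}} where

  infix 4 _≈_ _≈?_

  _≈_ : ℕ → ℕ → Set
  a ≈ b = a % u ≡ b % u

  _≈?_ : (a b : ℕ) → Dec (a ≈ b)
  a ≈? b = a % u ℕ.≟ b % u

  ≈⇒≡ : ∀ {a b} → a < u → b < u → a ≈ b → a ≡ b
  ≈⇒≡ a<u b<u a≈b = trans (sym (m<n⇒m%n≡m a<u)) (trans a≈b (m<n⇒m%n≡m b<u))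

  +-congʳ-≈ : ∀ {a b} c → a ≈ b → a + c ≈ b + c
  +-congʳ-≈ {a} {b} c a≈b = begin
    (a + c) % u         ≡⟨ %-distribˡ-+ a c u ⟩
    (a % u + c % u) % u ≡⟨ cong (λ t → (t + c % u) % u) a≈b ⟩
    (b % u + c % u) % u ≡⟨ %-distribˡ-+ b c u ⟨
    (b + c) % u         ∎
    where open ≡-Reasoning

  +-congˡ-≈ : ∀ {a b} c → a ≈ b → c + a ≈ c + b
  +-congˡ-≈ {a} {b} c a≈b = subst₂ _≈_ (+-comm a c) (+-comm b c) (+-congʳ-≈ c a≈b)

  +-inverseʳ-≈ : ∀ a c → a + c + (u ∸ c % u) ≈ a
  +-inverseʳ-≈ a c = begin
    (a + c + (u ∸ c % u)) % u       ≡⟨ +-congʳ-≈ (u ∸ c % u) (+-congˡ-≈ a (m%n%n≡m%n c u)) ⟨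
    (a + c % u + (u ∸ c % u)) % u   ≡⟨ cong (_% u) (+-assoc a (c % u) (u ∸ c % u)) ⟩
    (a + (c % u + (u ∸ c % u))) % u ≡⟨ cong (λ t → (a + t) % u) (m+[n∸m]≡n (m%n≤n c u)) ⟩
    (a + u) % u                     ≡⟨ [m+n]%n≡m%n a u ⟩
    a % u                           ∎
    where open ≡-Reasoning

  +-cancelʳ-≈ : ∀ {a b} c → a + c ≈ b + c → a ≈ b
  +-cancelʳ-≈ {a} {b} c a+c≈b+c = begin
    a % u                     ≡⟨ +-inverseʳ-≈ a c ⟨
    (a + c + (u ∸ c % u)) % u ≡⟨ +-congʳ-≈ (u ∸ c % u) a+c≈b+c ⟩
    (b + c + (u ∸ c % u)) % u ≡⟨ +-inverseʳ-≈ b c ⟩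
    b % u                     ∎
    where open ≡-Reasoning

  +-cancelˡ-≈ : ∀ {a b} c → c + a ≈ c + b → a ≈ b
  +-cancelˡ-≈ {a} {b} c c+a≈c+b = +-cancelʳ-≈ c (subst₂ _≈_ (+-comm c a) (+-comm c b) c+a≈c+b)

  infixl 6 _+ᵤ_ _-ᵤ_

  _+ᵤ_ : Fin u → ℕ → Fin u
  z +ᵤ a = (toℕ z + a) mod u

  -- Subtracting a % u rather than a keeps the truncated subtraction from saturating.
  _-ᵤ_ : Fin u → ℕ → Fin u
  z -ᵤ a = z +ᵤ (u ∸ a % u)

  toℕ-+ᵤ : ∀ z a → toℕ (z +ᵤ a) ≈ toℕ z + a
  toℕ-+ᵤ z a = trans (cong (_% u) (toℕ-fromℕ< (m%n<n (toℕ z + a) u))) (m%n%n≡m%n (toℕ z + a) u)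

  toℕ-≈⇔≡ : ∀ {x y : Fin u} → toℕ x ≈ toℕ y ⇔ x ≡ y
  toℕ-≈⇔≡ {x} {y} = mk⇔ (toℕ-injective ∘ ≈⇒≡ (toℕ<n x) (toℕ<n y)) (λ { refl → refl })

  +ᵤ-≡⇔ : ∀ z a x → z +ᵤ a ≡ x ⇔ toℕ z + a ≈ toℕ x
  +ᵤ-≡⇔ z a x = mk⇔ (λ z+a≡x → trans (sym (toℕ-+ᵤ z a)) (cong (λ w → toℕ w % u) z+a≡x))
                    (λ z+a≈x → to toℕ-≈⇔≡ (trans (toℕ-+ᵤ z a) z+a≈x))

  +ᵤ-≡⇔≡-ᵤ : ∀ z a x → z +ᵤ a ≡ x ⇔ z ≡ x -ᵤ a
  +ᵤ-≡⇔≡-ᵤ z a x = mk⇔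
    (λ z+a≡x → sym (from (+ᵤ-≡⇔ x _ z)
      (trans (+-congʳ-≈ (u ∸ a % u) (sym (to (+ᵤ-≡⇔ z a x) z+a≡x))) (+-inverseʳ-≈ (toℕ z) a))))
    (λ z≡x-a → from (+ᵤ-≡⇔ z a x)
      (trans (+-congʳ-≈ a (sym (to (+ᵤ-≡⇔ x _ z) (sym z≡x-a))))
             (trans (cong (_% u) (xy∙z≈xz∙y (toℕ x) _ a)) (+-inverseʳ-≈ (toℕ x) a))))

  +ᵤ-cancelˡ : ∀ z {a b} → a < u → b < u → z +ᵤ a ≡ z +ᵤ b → a ≡ b
  +ᵤ-cancelˡ z a<u b<u z+a≡z+b =
    ≈⇒≡ a<u b<u (+-cancelˡ-≈ (toℕ z) (trans (to (+ᵤ-≡⇔ z _ _) z+a≡z+b) (toℕ-+ᵤ z _)))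

  -ᵤ-cancelʳ : ∀ {x y} a → x -ᵤ a ≡ y -ᵤ a → x ≡ y
  -ᵤ-cancelʳ {x} {y} a x-a≡y-a = to toℕ-≈⇔≡
    (+-cancelʳ-≈ (u ∸ a % u) (trans (to (+ᵤ-≡⇔ x _ _) x-a≡y-a) (toℕ-+ᵤ y _)))

  +-≈ˡ⇒≈0 : ∀ a {c} → a + c ≈ a → c ≈ 0
  +-≈ˡ⇒≈0 a a+c≈a = +-cancelˡ-≈ a (trans a+c≈a (cong (_% u) (sym (+-identityʳ a))))

  ≈0⇒≡0 : ∀ {c} → c < u → c ≈ 0 → c ≡ 0
  ≈0⇒≡0 c<u = ≈⇒≡ c<u (>-nonZero⁻¹ u)

  -- Cyclic distance

  AtDistance : ℕ → ℕ → ℕ → Set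
  AtDistance e a b = a + e ≈ b ⊎ b + e ≈ a

  Admissible : ℕ → Set
  Admissible e = 0 < e × e + e < u

  Admissible⇒< : ∀ {e} → Admissible e → e < u
  Admissible⇒< {e} (_ , e+e<u) = ≤-<-trans (m≤m+n e e) e+e<u

  Admissible⇒≉0 : ∀ {e} → Admissible e → ¬ (e ≈ 0)
  Admissible⇒≉0 adm@(0<e , _) e≈0 = <⇒≢ 0<e (sym (≈0⇒≡0 (Admissible⇒< adm) e≈0))

  AtDistance-exclusive : ∀ {e a b} → Admissible e → ¬ (a + e ≈ b × b + e ≈ a)
  AtDistance-exclusive {e} {a} {b} (0<e , e+e<u) (a+e≈b , b+e≈a) =
    <⇒≢ (≤-trans 0<e (m≤m+n e e)) (sym (≈0⇒≡0 e+e<u (+-≈ˡ⇒≈0 a a+[e+e]≈a)))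
    where
    a+[e+e]≈a : a + (e + e) ≈ a
    a+[e+e]≈a = trans (cong (_% u) (sym (+-assoc a e e))) (trans (+-congʳ-≈ e a+e≈b) b+e≈a)

  ⊓-∸-≡⇔ : ∀ {t e} → t ≤ u → Admissible e → t ⊓ (u ∸ t) ≡ e ⇔ (t ≡ e ⊎ u ∸ t ≡ e)
  ⊓-∸-≡⇔ {t} {e} t≤u (_ , e+e<u) = mk⇔ selected minimal
    where
    selected : t ⊓ (u ∸ t) ≡ e → t ≡ e ⊎ u ∸ t ≡ e
    selected t⊓≡e = Sum.map (λ t⊓≡t → trans (sym t⊓≡t) t⊓≡e) (λ t⊓≡u∸t → trans (sym t⊓≡u∸t) t⊓≡e)
                            (⊓-sel t (u ∸ t))
    minimal : t ≡ e ⊎ u ∸ t ≡ e → t ⊓ (u ∸ t) ≡ e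
    minimal (inj₁ refl) = m≤n⇒m⊓n≡m (m+n≤o⇒m≤o∸n t (<⇒≤ e+e<u))
    minimal (inj₂ refl) = m≥n⇒m⊓n≡n (<⇒≤ (+-cancelʳ-< (u ∸ t) (u ∸ t) t
                            (subst (u ∸ t + (u ∸ t) <_) (sym (m+[n∸m]≡n t≤u)) e+e<u)))

  +-≈-+⇔ : ∀ {e} a t → t < u → e < u → a + e ≈ a + t ⇔ t ≡ e
  +-≈-+⇔ a t t<u e<u = mk⇔ (λ a+e≈a+t → sym (≈⇒≡ e<u t<u (+-cancelˡ-≈ a a+e≈a+t)))
                           (λ t≡e → cong (λ w → (a + w) % u) (sym t≡e))

  +-+-≈⇔ : ∀ {e} a t → t ≤ u → Admissible e → a + t + e ≈ a ⇔ u ∸ t ≡ e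
  +-+-≈⇔ {e} a zero _ adm = mk⇔
    (λ a+0+e≈a → ⊥-elim (Admissible⇒≉0 adm (+-≈ˡ⇒≈0 a
                   (trans (cong (λ w → (w + e) % u) (sym (+-identityʳ a))) a+0+e≈a))))
    (λ u≡e → ⊥-elim (<⇒≢ (Admissible⇒< adm) (sym u≡e)))
  +-+-≈⇔ {e} a t@(suc _) t≤u adm = mk⇔
    (λ a+t+e≈a → sym (≈⇒≡ (Admissible⇒< adm) (∸-monoʳ-< z<s t≤u)
                       (+-cancelˡ-≈ (a + t) (trans a+t+e≈a (sym a+t+[u∸t]≈a)))))
    (λ { refl → a+t+[u∸t]≈a })
    where
    a+t+[u∸t]≈a : a + t + (u ∸ t) ≈ a
    a+t+[u∸t]≈a = trans (cong (_% u) (trans (+-assoc a t (u ∸ t)) (cong (a +_) (m+[n∸m]≡n t≤u))))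
                        ([m+n]%n≡m%n a u)

  AtDistance-+⇔ : ∀ {e} a t → t < u → Admissible e → AtDistance e a (a + t) ⇔ (t ≡ e ⊎ u ∸ t ≡ e)
  AtDistance-+⇔ a t t<u adm = +-≈-+⇔ a t t<u (Admissible⇒< adm) ⊎-⇔ +-+-≈⇔ a t (<⇒≤ t<u) adm

  ∣_-_∣ᵤ : ℕ → ℕ → ℕ
  ∣ a - b ∣ᵤ = ∣ a - b ∣ ⊓ (u ∸ ∣ a - b ∣)

  ∣-∣ᵤ-comm : ∀ a b → ∣ a - b ∣ᵤ ≡ ∣ b - a ∣ᵤ
  ∣-∣ᵤ-comm a b = cong (λ t → t ⊓ (u ∸ t)) (∣-∣-comm a b)

  ∣-∣ᵤ-≡⇔ : ∀ {e a b} → Admissible e → a ≤ b → b < u → ∣ a - b ∣ᵤ ≡ e ⇔ AtDistance e a b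
  ∣-∣ᵤ-≡⇔ {e} {a} {b} adm a≤b b<u =
    subst (λ c → ∣ a - c ∣ᵤ ≡ e ⇔ AtDistance e a c) (m+[n∸m]≡n a≤b)
          (shifted (≤-<-trans (m∸n≤m b a) b<u))
    where
    shifted : ∀ {t} → t < u → ∣ a - a + t ∣ᵤ ≡ e ⇔ AtDistance e a (a + t)
    shifted {t} t<u rewrite ∣m-m+n∣≡n a t =
      ⇔.trans (⊓-∸-≡⇔ (<⇒≤ t<u) adm) (⇔.sym (AtDistance-+⇔ a t t<u adm))

  distU-≡⇔ : ∀ {e} → Admissible e → (x y : Fin u) → distU x y ≡ e ⇔ AtDistance e (toℕ x) (toℕ y)
  distU-≡⇔ adm x y with ≤-total (toℕ x) (toℕ y)
  ... | inj₁ x≤y = ∣-∣ᵤ-≡⇔ adm x≤y (toℕ<n y)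
  ... | inj₂ y≤x = ⇔.trans (mk⇔ (trans (sym comm)) (trans comm))
                           (⇔.trans (∣-∣ᵤ-≡⇔ adm y≤x (toℕ<n x)) (mk⇔ Sum.swap Sum.swap))
    where
    comm : ∣ toℕ x - toℕ y ∣ᵤ ≡ ∣ toℕ y - toℕ x ∣ᵤ
    comm = ∣-∣ᵤ-comm (toℕ x) (toℕ y)

  AtDistance⇒≢ : ∀ {e} {x y : Fin u} → Admissible e → AtDistance e (toℕ x) (toℕ y) → x ≢ y
  AtDistance⇒≢ {x = x} adm d refl = Admissible⇒≉0 adm ([ +-≈ˡ⇒≈0 (toℕ x) , +-≈ˡ⇒≈0 (toℕ x) ] d)

  AtDistance-+ᵤ : ∀ {e α β} z → AtDistance e α β → AtDistance e (toℕ (z +ᵤ α)) (toℕ (z +ᵤ β))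
  AtDistance-+ᵤ z = Sum.map translated translated
    where
    translated : ∀ {e α β} → α + e ≈ β → toℕ (z +ᵤ α) + e ≈ toℕ (z +ᵤ β)
    translated {e} {α} {β} α+e≈β = begin
      (toℕ (z +ᵤ α) + e) % u ≡⟨ +-congʳ-≈ e (toℕ-+ᵤ z α) ⟩
      (toℕ z + α + e) % u    ≡⟨ cong (_% u) (+-assoc (toℕ z) α e) ⟩
      (toℕ z + (α + e)) % u  ≡⟨ +-congˡ-≈ (toℕ z) α+e≈β ⟩
      (toℕ z + β) % u        ≡⟨ toℕ-+ᵤ z β ⟨
      toℕ (z +ᵤ β) % u       ∎
      where open ≡-Reasoning

  +-shift-⇔ : ∀ {α β e} a b → α + e ≈ β → a + β ≈ b + α ⇔ a + e ≈ b
  +-shift-⇔ {α} {β} {e} a b α+e≈β =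
    mk⇔ (λ a+β≈b+α → +-cancelʳ-≈ α (trans (sym a+β≈a+e+α) a+β≈b+α))
        (λ a+e≈b → trans a+β≈a+e+α (+-congʳ-≈ α a+e≈b))
    where
    a+β≈a+e+α : a + β ≈ a + e + α
    a+β≈a+e+α = trans (sym (+-congˡ-≈ a α+e≈β)) (cong (_% u) (x∙yz≈xz∙y a α e))

  translate-pair-⇔ : ∀ z α β x y →
    (z +ᵤ α ≡ x × z +ᵤ β ≡ y) ⇔ (z ≡ x -ᵤ α × toℕ x + β ≈ toℕ y + α)
  translate-pair-⇔ z α β x y = mk⇔
    (λ (z+α≡x , z+β≡y) → to (+ᵤ-≡⇔≡-ᵤ z α x) z+α≡x ,
       trans (+-congʳ-≈ β (sym (to (+ᵤ-≡⇔ z α x) z+α≡x)))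
             (trans (cong (_% u) (xy∙z≈xz∙y (toℕ z) α β)) (+-congʳ-≈ α (to (+ᵤ-≡⇔ z β y) z+β≡y))))
    (λ (z≡x-α , x+β≈y+α) → let z+α≡x = from (+ᵤ-≡⇔≡-ᵤ z α x) z≡x-α in z+α≡x ,
       from (+ᵤ-≡⇔ z β y) (+-cancelʳ-≈ α
         (trans (cong (_% u) (xy∙z≈xz∙y (toℕ z) β α))
                (trans (+-congʳ-≈ β (to (+ᵤ-≡⇔ z α x) z+α≡x)) x+β≈y+α))))

  𝟙-AtDistance : ∀ {e} → Admissible e → (x y : Fin u) →
    𝟙 (toℕ x + e ≈? toℕ y) + 𝟙 (toℕ y + e ≈? toℕ x) ≡ 𝟙 (distU x y ℕ.≟ e)
  𝟙-AtDistance {e} adm x y = begin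
    𝟙 x+e≈?y + 𝟙 y+e≈?x     ≡⟨ 𝟙-⊎ (AtDistance-exclusive {e} {toℕ x} {toℕ y} adm) x+e≈?y y+e≈?x ⟨
    𝟙 (x+e≈?y ⊎-dec y+e≈?x) ≡⟨ 𝟙-⇔ (⇔.sym (distU-≡⇔ adm x y)) _ (distU x y ℕ.≟ e) ⟩
    𝟙 (distU x y ℕ.≟ e)     ∎
    where
    open ≡-Reasoning
    x+e≈?y : Dec (toℕ x + e ≈ toℕ y)
    x+e≈?y = toℕ x + e ≈? toℕ y
    y+e≈?x : Dec (toℕ y + e ≈ toℕ x)
    y+e≈?x = toℕ y + e ≈? toℕ x

  -- Translates of an edge

  finiteEdge : ℕ → ℕ → Fin u → Edge (Vtx u)
  finiteEdge α β z = inj₁ (z +ᵤ α) , inj₁ (z +ᵤ β)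

  infiniteEdge : ℕ → Fin 2 → Fin u → Edge (Vtx u)
  infiniteEdge α h z = inj₁ (z +ᵤ α) , inj₂ h

  orbitCount : Vtx u → Vtx u → (Fin u → Edge (Vtx u)) → ℕ
  orbitCount x y E = ∑[ z < u ] 𝟙 (sameEdge? (E z) (x , y))

  orbitCount-finiteEdge : ∀ {e α β} → Admissible e → AtDistance e α β → {x y : Fin u} → x ≢ y →
    orbitCount (inj₁ x) (inj₁ y) (finiteEdge α β) ≡ 𝟙 (distU x y ℕ.≟ e)
  orbitCount-finiteEdge {e} {α} {β} adm α~β {x} {y} x≢y = begin
    orbitCount (inj₁ x) (inj₁ y) (finiteEdge α β)
      ≡⟨ ∑-𝟙-pair _ (x -ᵤ α) (y -ᵤ α) (toℕ x + β ≈? toℕ y + α) (toℕ y + β ≈? toℕ x + α)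
                  (x≢y ∘ -ᵤ-cancelʳ α) sameEdge⇔ ⟩
    𝟙 (toℕ x + β ≈? toℕ y + α) + 𝟙 (toℕ y + β ≈? toℕ x + α)
      ≡⟨ oriented α~β ⟩
    𝟙 (toℕ x + e ≈? toℕ y) + 𝟙 (toℕ y + e ≈? toℕ x)
      ≡⟨ 𝟙-AtDistance adm x y ⟩
    𝟙 (distU x y ℕ.≟ e) ∎
    where
    open ≡-Reasoning
    inj₁-⇔ : ∀ {a b : Fin u} → (inj₁ a ≡ inj₁ b) ⇔ (a ≡ b)
    inj₁-⇔ = mk⇔ inj₁-injective (cong inj₁)
    sameEdge⇔ : ∀ z → SameEdge (inj₁ (z +ᵤ α) , inj₁ (z +ᵤ β)) (inj₁ x , inj₁ y) ⇔
                      ((z ≡ x -ᵤ α × toℕ x + β ≈ toℕ y + α) ⊎ (z ≡ y -ᵤ α × toℕ y + β ≈ toℕ x + α))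
    sameEdge⇔ z = ⇔.trans ((inj₁-⇔ ×-⇔ inj₁-⇔) ⊎-⇔ (inj₁-⇔ ×-⇔ inj₁-⇔))
                          (translate-pair-⇔ z α β x y ⊎-⇔ translate-pair-⇔ z α β y x)
    oriented : AtDistance e α β →
      𝟙 (toℕ x + β ≈? toℕ y + α) + 𝟙 (toℕ y + β ≈? toℕ x + α) ≡
      𝟙 (toℕ x + e ≈? toℕ y) + 𝟙 (toℕ y + e ≈? toℕ x)
    oriented (inj₁ α+e≈β) = cong₂ _+_ (shifted (toℕ x) (toℕ y)) (shifted (toℕ y) (toℕ x))
      where
      shifted : ∀ a b → 𝟙 (a + β ≈? b + α) ≡ 𝟙 (a + e ≈? b)
      shifted a b = 𝟙-⇔ (+-shift-⇔ {α} {β} {e} a b α+e≈β) (a + β ≈? b + α) (a + e ≈? b)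
    oriented (inj₂ β+e≈α) = trans (cong₂ _+_ (flipped (toℕ x) (toℕ y)) (flipped (toℕ y) (toℕ x)))
                                  (+-comm (𝟙 (toℕ y + e ≈? toℕ x)) (𝟙 (toℕ x + e ≈? toℕ y)))
      where
      flipped : ∀ a b → 𝟙 (a + β ≈? b + α) ≡ 𝟙 (b + e ≈? a)
      flipped a b =
        𝟙-⇔ (⇔.trans (mk⇔ sym sym) (+-shift-⇔ {β} {α} {e} b a β+e≈α)) (a + β ≈? b + α) (b + e ≈? a)

  orbitCount-infiniteEdge : ∀ α h x k → orbitCount (inj₁ x) (inj₂ k) (infiniteEdge α h) ≡ 𝟙 (h Finₚ.≟ k)
  orbitCount-infiniteEdge α h x k =
    ∑-𝟙-single _ (x -ᵤ α) (h Finₚ.≟ k) (λ z → mk⇔ (matched z) (matching z))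
    where
    matched : ∀ z → SameEdge (inj₁ (z +ᵤ α) , inj₂ h) (inj₁ x , inj₂ k) → z ≡ x -ᵤ α × h ≡ k
    matched z (inj₁ (z+α≡x , h≡k)) = to (+ᵤ-≡⇔≡-ᵤ z α x) (inj₁-injective z+α≡x) , inj₂-injective h≡k
    matching : ∀ z → z ≡ x -ᵤ α × h ≡ k → SameEdge (inj₁ (z +ᵤ α) , inj₂ h) (inj₁ x , inj₂ k)
    matching z (z≡x-α , refl) = inj₁ (cong inj₁ (from (+ᵤ-≡⇔≡-ᵤ z α x) z≡x-α) , refl)

  orbitCount-finiteEdge-∞ : ∀ α β x k → orbitCount (inj₁ x) (inj₂ k) (finiteEdge α β) ≡ 0
  orbitCount-finiteEdge-∞ α β x k = ∑-𝟙-∅ (λ z → sameEdge? (finiteEdge α β z) (inj₁ x , inj₂ k))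
                                           (λ _ → λ { (inj₁ (_ , ())) ; (inj₂ (() , _)) })

  orbitCount-infiniteEdge-finite : ∀ α h x y → orbitCount (inj₁ x) (inj₁ y) (infiniteEdge α h) ≡ 0
  orbitCount-infiniteEdge-finite α h x y = ∑-𝟙-∅ (λ z → sameEdge? (infiniteEdge α h z) (inj₁ x , inj₁ y))
                                                  (λ _ → λ { (inj₁ (_ , ())) ; (inj₂ (_ , ())) })

  -- Developing a base sun

  record BaseSun (e₁ e₂ e₃ e₄ : ℕ) : Set where
    field
      p q r              : ℕ
      p<u                : p < u
      q<u                : q < u
      r<u                : r < u
      offsets-distinct   : Unique (0 ∷ p ∷ q ∷ r ∷ [])
      ab                 : AtDistance e₁ 0 p
      bc                 : AtDistance e₂ p q
      ca                 : AtDistance e₃ q 0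
      ad                 : AtDistance e₄ 0 r
      admissible         : All Admissible (e₁ ∷ e₂ ∷ e₃ ∷ e₄ ∷ [])
      distances-distinct : Unique (e₁ ∷ e₂ ∷ e₃ ∷ e₄ ∷ [])

  module Development {e₁ e₂ e₃ e₄} (B : BaseSun e₁ e₂ e₃ e₄) where
    open BaseSun B

    distances : List ℕ
    distances = e₁ ∷ e₂ ∷ e₃ ∷ e₄ ∷ []

    translate : Fin u → Sun (Vtx u)
    translate z = record
      { a = inj₁ (z +ᵤ 0) ; b = inj₁ (z +ᵤ p) ; c = inj₁ (z +ᵤ q) ; d = inj₁ (z +ᵤ r)
      ; e = inj₂ 0F ; f = inj₂ 1F
      ; distinct = distinct offsets-distinct }
      where
      apart : ∀ {α β} → α < u → β < u → α ≢ β → _≢_ {A = Vtx u} (inj₁ (z +ᵤ α)) (inj₁ (z +ᵤ β))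
      apart α<u β<u α≢β = α≢β ∘ +ᵤ-cancelˡ z α<u β<u ∘ inj₁-injective
      distinct : Unique (0 ∷ p ∷ q ∷ r ∷ []) →
                 Unique (inj₁ (z +ᵤ 0) ∷ inj₁ (z +ᵤ p) ∷ inj₁ (z +ᵤ q) ∷ inj₁ (z +ᵤ r)
                         ∷ inj₂ 0F ∷ inj₂ 1F ∷ [])
      distinct ((0≢p ∷ 0≢q ∷ 0≢r ∷ []) ∷ (p≢q ∷ p≢r ∷ []) ∷ (q≢r ∷ []) ∷ [] ∷ []) =
          (apart 0<u p<u 0≢p ∷ apart 0<u q<u 0≢q ∷ apart 0<u r<u 0≢r ∷ (λ ()) ∷ (λ ()) ∷ [])
        ∷ (apart p<u q<u p≢q ∷ apart p<u r<u p≢r ∷ (λ ()) ∷ (λ ()) ∷ [])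
        ∷ (apart q<u r<u q≢r ∷ (λ ()) ∷ (λ ()) ∷ [])
        ∷ ((λ ()) ∷ (λ ()) ∷ [])
        ∷ ((λ ()) ∷ [])
        ∷ [] ∷ []
        where
        0<u : 0 < u
        0<u = >-nonZero⁻¹ u

    development : List (Sun (Vtx u))
    development = tabulate translate

    admissible-∈ : ∀ {e} → e ∈ distances → Admissible e
    admissible-∈ = All.lookup admissible

    finiteEdge-adjacent : ∀ {e α β} z → AtDistance e α β → e ∈ distances →
                          Adj distances (inj₁ (z +ᵤ α)) (inj₁ (z +ᵤ β))
    finiteEdge-adjacent {e} {α} {β} z α~β e∈ =
      AtDistance⇒≢ (admissible-∈ e∈) translated ,
      subst (_∈ distances) (sym (from (distU-≡⇔ (admissible-∈ e∈) _ _) translated)) e∈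
      where
      translated : AtDistance e (toℕ (z +ᵤ α)) (toℕ (z +ᵤ β))
      translated = AtDistance-+ᵤ z α~β

    edges-adjacent : ∀ z → All (λ { (x , y) → Adj distances x y }) (sunEdges (translate z))
    edges-adjacent z =
        finiteEdge-adjacent z ab (here refl)
      ∷ finiteEdge-adjacent z bc (there (here refl))
      ∷ finiteEdge-adjacent z ca (there (there (here refl)))
      ∷ finiteEdge-adjacent z ad (there (there (there (here refl))))
      ∷ tt ∷ tt ∷ []

    orbits : List (Fin u → Edge (Vtx u))
    orbits = finiteEdge 0 p ∷ finiteEdge p q ∷ finiteEdge q 0 ∷ finiteEdge 0 r
           ∷ infiniteEdge p 0F ∷ infiniteEdge q 1F ∷ []

    edgeCount-orbits : ∀ x y → edgeCount development x y ≡ sum (map (orbitCount x y) orbits)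
    edgeCount-orbits x y =
      trans (edgeCount-tabulate translate x y)
            (∑-sum-map (map (λ E z → 𝟙 (sameEdge? (E z) (x , y))) orbits))

    edgeCount-≡1 : ∀ x y → Adj distances x y → edgeCount development x y ≡ 1
    edgeCount-≡1 (inj₁ x) (inj₁ y) (x≢y , d∈) = begin
      edgeCount development (inj₁ x) (inj₁ y)            ≡⟨ edgeCount-orbits (inj₁ x) (inj₁ y) ⟩
      sum (map (orbitCount (inj₁ x) (inj₁ y)) orbits)
        ≡⟨ cong₂ _+_ (finite ab (here refl)) (cong₂ _+_ (finite bc (there (here refl)))
             (cong₂ _+_ (finite ca (there (there (here refl))))
             (cong₂ _+_ (finite ad (there (there (there (here refl)))))
             (cong₂ _+_ (orbitCount-infiniteEdge-finite p 0F x y)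
                        (cong (_+ 0) (orbitCount-infiniteEdge-finite q 1F x y)))))) ⟩
      sum (map (λ e → 𝟙 (distU x y ℕ.≟ e)) distances)    ≡⟨ sum-𝟙-unique ℕ._≟_ distances-distinct d∈ ⟩
      1                                                  ∎
      where
      open ≡-Reasoning
      finite : ∀ {e α β} → AtDistance e α β → e ∈ distances →
               orbitCount (inj₁ x) (inj₁ y) (finiteEdge α β) ≡ 𝟙 (distU x y ℕ.≟ e)
      finite α~β e∈ = orbitCount-finiteEdge (admissible-∈ e∈) α~β x≢y
    edgeCount-≡1 (inj₁ x) (inj₂ k) _ = begin
      edgeCount development (inj₁ x) (inj₂ k)            ≡⟨ edgeCount-orbits (inj₁ x) (inj₂ k) ⟩
      sum (map (orbitCount (inj₁ x) (inj₂ k)) orbits)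
        ≡⟨ cong₂ _+_ (orbitCount-finiteEdge-∞ 0 p x k) (cong₂ _+_ (orbitCount-finiteEdge-∞ p q x k)
             (cong₂ _+_ (orbitCount-finiteEdge-∞ q 0 x k) (cong₂ _+_ (orbitCount-finiteEdge-∞ 0 r x k)
             (cong₂ _+_ (orbitCount-infiniteEdge p 0F x k)
                        (cong (_+ 0) (orbitCount-infiniteEdge q 1F x k)))))) ⟩
      ∑[ h < 2 ] 𝟙 (h Finₚ.≟ k)                          ≡⟨ ∑-𝟙-≟ k ⟩
      1                                                  ∎
      where open ≡-Reasoning
    edgeCount-≡1 (inj₂ k) (inj₁ x) _ =
      trans (edgeCount-comm development (inj₂ k) (inj₁ x)) (edgeCount-≡1 (inj₁ x) (inj₂ k) tt)
    edgeCount-≡1 (inj₂ _) (inj₂ _) ()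

  development-decomposes : ∀ {e₁ e₂ e₃ e₄} → BaseSun e₁ e₂ e₃ e₄ →
                           SunDecomposition u (e₁ ∷ e₂ ∷ e₃ ∷ e₄ ∷ [])
  development-decomposes B = development , tabulate⁺ edges-adjacent , edgeCount-≡1
    where open Development B

  Admissible⇒0≢ : ∀ {e} → Admissible e → 0 ≢ e
  Admissible⇒0≢ = <⇒≢ ∘ proj₁

  baseSun-difference : ∀ {d₁ d₂ d₃ d₄} → All Admissible (d₁ ∷ d₂ ∷ d₃ ∷ d₄ ∷ []) →
                       Unique (d₁ ∷ d₂ ∷ d₃ ∷ d₄ ∷ []) → d₃ + d₁ ≡ d₂ → BaseSun d₁ d₃ d₂ d₄
  baseSun-difference {d₁} {d₂} {d₃} {d₄} (adm₁ ∷ adm₂ ∷ adm₃ ∷ adm₄ ∷ [])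
    ((d₁≢d₂ ∷ d₁≢d₃ ∷ d₁≢d₄ ∷ []) ∷ (d₂≢d₃ ∷ d₂≢d₄ ∷ []) ∷ (d₃≢d₄ ∷ []) ∷ [] ∷ []) d₃+d₁≡d₂ = record
    { p = d₁ ; q = d₂ ; r = d₄
    ; p<u = Admissible⇒< adm₁ ; q<u = Admissible⇒< adm₂ ; r<u = Admissible⇒< adm₄
    ; offsets-distinct = (Admissible⇒0≢ adm₁ ∷ Admissible⇒0≢ adm₂ ∷ Admissible⇒0≢ adm₄ ∷ [])
                       ∷ (d₁≢d₂ ∷ d₁≢d₄ ∷ []) ∷ (d₂≢d₄ ∷ []) ∷ [] ∷ []
    ; ab = inj₁ refl
    ; bc = inj₁ (cong (_% u) (trans (+-comm d₁ d₃) d₃+d₁≡d₂))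
    ; ca = inj₂ refl
    ; ad = inj₁ refl
    ; admissible = adm₁ ∷ adm₃ ∷ adm₂ ∷ adm₄ ∷ []
    ; distances-distinct = (d₁≢d₃ ∷ d₁≢d₂ ∷ d₁≢d₄ ∷ []) ∷ ((d₂≢d₃ ∘ sym) ∷ d₃≢d₄ ∷ [])
                         ∷ (d₂≢d₄ ∷ []) ∷ [] ∷ []
    }

  baseSun-sum : ∀ {d₁ d₂ d₃ d₄} → All Admissible (d₁ ∷ d₂ ∷ d₃ ∷ d₄ ∷ []) →
                Unique (d₁ ∷ d₂ ∷ d₃ ∷ d₄ ∷ []) → d₁ + d₂ + d₃ ≡ u → BaseSun d₁ d₂ d₃ d₄
  baseSun-sum {d₁} {d₂} {d₃} {d₄} admissible@(adm₁ ∷ adm₂ ∷ adm₃ ∷ adm₄ ∷ [])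
              distinct@((_ ∷ _ ∷ d₁≢d₄ ∷ []) ∷ _) d₁+d₂+d₃≡u = record
    { p = d₁ ; q = d₁ + d₂ ; r = d₄
    ; p<u = Admissible⇒< adm₁
    ; q<u = subst (d₁ + d₂ <_) d₁+d₂+d₃≡u (m<m+n (d₁ + d₂) (proj₁ adm₃))
    ; r<u = Admissible⇒< adm₄
    ; offsets-distinct = (Admissible⇒0≢ adm₁ ∷ <⇒≢ (≤-trans (proj₁ adm₁) (m≤m+n d₁ d₂))
                                              ∷ Admissible⇒0≢ adm₄ ∷ [])
                       ∷ (<⇒≢ (m<m+n d₁ (proj₁ adm₂)) ∷ d₁≢d₄ ∷ [])
                       ∷ (d₁+d₂≢d₄ ∷ []) ∷ [] ∷ []
    ; ab = inj₁ refl
    ; bc = inj₁ refl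
    ; ca = inj₁ (trans (cong (_% u) d₁+d₂+d₃≡u) ([m+n]%n≡m%n 0 u))
    ; ad = inj₁ refl
    ; admissible = admissible
    ; distances-distinct = distinct
    }
    where
    d₁+d₂≢d₄ : d₁ + d₂ ≢ d₄
    d₁+d₂≢d₄ d₁+d₂≡d₄ = <⇒≢ (m+m<o⇒n+n<o⇒m+n<o {d₄} {d₃} (proj₂ adm₄) (proj₂ adm₃))
                              (trans (cong (_+ d₃) (sym d₁+d₂≡d₄)) d₁+d₂+d₃≡u)

Adj-mono : ∀ {u} {D D′ : List ℕ} → (∀ {m} → m ∈ D → m ∈ D′) →
           (x y : Vtx u) → Adj D x y → Adj D′ x y
Adj-mono D⊆D′ (inj₁ i) (inj₁ j) (i≢j , d∈D) = i≢j , D⊆D′ d∈D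
Adj-mono D⊆D′ (inj₁ i) (inj₂ h) tt = tt
Adj-mono D⊆D′ (inj₂ h) (inj₁ j) tt = tt
Adj-mono D⊆D′ (inj₂ h) (inj₂ k) ()

SunDecomposition-resp-↭ : ∀ {u} {D D′ : List ℕ} → D ↭ D′ →
                          SunDecomposition u D → SunDecomposition u D′
SunDecomposition-resp-↭ D↭D′ (S , adjacent , counted) =
  S , All.map (All.map (λ { {x , y} → Adj-mono (∈-resp-↭ D↭D′) x y })) adjacent ,
  λ x y → counted x y ∘ Adj-mono (∈-resp-↭ (↭-sym D↭D′)) x y

halfBound⇒Admissible : ∀ {u} .{{_ : NonZero u}} {d} →
                       1 ≤ d × d ≤ u / 2 × ¬ (2 * d ≡ u) → CyclicArithmetic.Admissible u d
halfBound⇒Admissible {u} {d} (1≤d , d≤u/2 , 2d≢u) = 1≤d , ≤∧≢⇒< d+d≤u (2d≢u ∘ trans 2d≡d+d)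
  where
  2d≡d+d : 2 * d ≡ d + d
  2d≡d+d = cong (d +_) (+-identityʳ d)
  d+d≤u : d + d ≤ u
  d+d≤u = subst (_≤ u) 2d≡d+d
                (≤-trans (*-monoʳ-≤ 2 d≤u/2) (subst (_≤ u) (*-comm (u / 2) 2) (m/n*n≤m u 2)))

lemma2p12 : (u d₁ d₂ d₃ d₄ : ℕ) →
    (1 ≤ d₁ × d₁ ≤ u / 2 × ¬ (2 * d₁ ≡ u)) →
    (1 ≤ d₂ × d₂ ≤ u / 2 × ¬ (2 * d₂ ≡ u)) →
    (1 ≤ d₃ × d₃ ≤ u / 2 × ¬ (2 * d₃ ≡ u)) →
    (1 ≤ d₄ × d₄ ≤ u / 2 × ¬ (2 * d₄ ≡ u)) →
    ¬ (d₁ ≡ d₂) → ¬ (d₁ ≡ d₃) → ¬ (d₁ ≡ d₄) →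
    ¬ (d₂ ≡ d₃) → ¬ (d₂ ≡ d₄) → ¬ (d₃ ≡ d₄) →
    (d₃ + d₁ ≡ d₂ ⊎ d₁ + d₂ + d₃ ≡ u) →
    SunDecomposition u (d₁ ∷ d₂ ∷ d₃ ∷ d₄ ∷ [])
lemma2p12 zero d₁ d₂ d₃ d₄ (1≤d₁ , d₁≤0 , _) _ _ _ _ _ _ _ _ _ _ = ⊥-elim (1+n≰n (≤-trans 1≤d₁ d₁≤0))
lemma2p12 u@(suc _) d₁ d₂ d₃ d₄ h₁ h₂ h₃ h₄ d₁≢d₂ d₁≢d₃ d₁≢d₄ d₂≢d₃ d₂≢d₄ d₃≢d₄ =
  [ (λ d₃+d₁≡d₂ → SunDecomposition-resp-↭ (prep d₁ (swap d₃ d₂ refl))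
                    (development-decomposes (baseSun-difference admissible distinct d₃+d₁≡d₂)))
  , (λ d₁+d₂+d₃≡u → development-decomposes (baseSun-sum admissible distinct d₁+d₂+d₃≡u)) ]
  where
  open CyclicArithmetic u
  admissible : All Admissible (d₁ ∷ d₂ ∷ d₃ ∷ d₄ ∷ [])
  admissible = halfBound⇒Admissible h₁ ∷ halfBound⇒Admissible h₂
             ∷ halfBound⇒Admissible h₃ ∷ halfBound⇒Admissible h₄ ∷ []
  distinct : Unique (d₁ ∷ d₂ ∷ d₃ ∷ d₄ ∷ [])
  distinct = (d₁≢d₂ ∷ d₁≢d₃ ∷ d₁≢d₄ ∷ []) ∷ (d₂≢d₃ ∷ d₂≢d₄ ∷ []) ∷ (d₃≢d₄ ∷ []) ∷ [] ∷ []
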